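{- Let $P$ be a finite set of constrained Horn clauses over a constraint theory $\mathbb{T}$, and let $P_{\mathit{dim}}$ be its dimension-instrumented version (defined in the context). Then for every predicate $p$ of $P$, every tuple $\bar t$ of elements of the domain of $\mathbb{T}$ of the arity of $p$, and every natural number $k$: $P_{\mathit{dim}} \vdash p'(\bar t,k)$ if and only if the atom $p(\bar t)$ has a derivation in $P$ (a feasible AND-tree of $P$ with root atom $p(\bar t)$) of dimension $k$.
   Context: A constrained Horn clause (CHC) is a formula $p_0(\bar x_0) \leftarrow \phi, p_1(\bar x_1),\ldots,p_n(\bar x_n)$ ($n\ge 0$), universally quantified, where $\phi$ is a conjunction of constraints in the theory $\mathbb{T}$, the $\bar x_i$ are tuples of variables and the $p_i$ are predicate symbols; the head may be the special predicate $\mathtt{false}$ (interpreted as false). Each clause has a unique identifier. An AND-tree (derivation tree) for a set of CHCs is a finite tree each of whose nodes corresponds to a clause $A \leftarrow \phi, A_1,\ldots,A_n$ of the set (with variables renamed so that variables occurring in the body but not the head do not occur in the labels of any ancestor), is labelled by the atom $A$, the constraint $\phi$ and the clause identifier, and has exactly $n$ children, labelled by atoms $A_1,\ldots,A_n$ respectively (leaves correspond to clauses with $n=0$). $\mathsf{constr}(t)$ is the conjunction of all constraints labelling nodes of $t$; $t$ is feasible if $\mathsf{constr}(t)$ is satisfiable in $\mathbb{T}$. For an atom $q(\bar t)$, we write $P \vdash q(\bar t)$ if there is a feasible AND-tree whose root is labelled by $q(\bar y)$ with $\mathsf{constr}(t)\wedge \bar y=\bar t$ satisfiable in $\mathbb{T}$;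 such a tree is called a derivation of $q(\bar t)$. Tree dimension: for a tree $t=c(t_1,\ldots,t_n)$, $\mathit{dim}(t)=0$ if $n=0$; if $n>0$ let $m=\max_i \mathit{dim}(t_i)$; then $\mathit{dim}(t)=m$ if exactly one index $i$ has $\mathit{dim}(t_i)=m$, and $\mathit{dim}(t)=m+1$ if more than one index attains $m$. The dimension of a derivation is the dimension of its AND-tree. Dimension-instrumented clauses $P_{\mathit{dim}}$: for each predicate $p$ of arity $a$ (including $\mathtt{false}$) introduce a predicate $p'$ of arity $a+1$. For each clause $p(\bar x) \leftarrow \phi, p_1(\bar x_1),\ldots,p_n(\bar x_n)$ of $P$, $P_{\mathit{dim}}$ contains the clause $p'(\bar x,k) \leftarrow \phi, p_1'(\bar x_1,k_1),\ldots,p_n'(\bar x_n,k_n), \mathit{dim}([k_1,\ldots,k_n],k)$, where $k_1,\ldots,k_n,k$ are fresh variables and $\mathit{dim}([k_1,\ldots,k_n],k)$ is the constraint expressing that $k$ is computed from $k_1,\ldots,k_n$ by the rule above: $k=0$ if $n=0$; otherwise, with $m=\max_i k_i$, $k=m$ if exactly one $k_i$ equals $m$ and $k=m+1$ if at least two $k_i$ equal $m$. -}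

module Defs where

open import Data.Nat using (ℕ; zero; suc; _⊔_)
open import Data.Nat.Properties using (_≟_)
open import Data.Fin using (Fin)
open import Data.List using (List; []; _∷_; map; _++_; length; replicate; filter; foldr)
open import Data.List.Relation.Unary.All as All using (All; []; _∷_; lookup)
open import Data.List.Relation.Unary.All.Properties using (++⁺)
open import Data.List.Relation.Unary.Any using (here; there)
open import Data.List.Membership.Propositional using (_∈_)
open import Data.List.Membership.Propositional.Properties using (∈-map⁺; ∈-++⁺ˡ; ∈-++⁺ʳ)
open import Data.Product using (Σ; _×_; _,_; proj₁; proj₂)
open import Data.Sum using (_⊎_; inj₁; inj₂)
open import Data.Unit using (⊤; tt)
open import Relation.Binary.PropositionalEquality using (_≡_; refl)

-- Tree dimension rule: dim([k₁,…,kₙ]) as in the paper.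
--   n = 0            ↦ 0
--   n > 0, m = max kᵢ: m if exactly one kᵢ = m, m+1 if at least two.

maxList : List ℕ → ℕ
maxList = foldr _⊔_ 0

count : ℕ → List ℕ → ℕ
count m ks = length (filter (_≟ m) ks)

bump : ℕ → ℕ → ℕ
bump m (suc (suc _)) = suc m
bump m _             = m

dimOf : List ℕ → ℕ
dimOf []       = 0
dimOf (k ∷ ks) = bump (maxList (k ∷ ks)) (count (maxList (k ∷ ks)) (k ∷ ks))

-- Constrained Horn clauses over a (many-sorted) constraint theory.
--  * Sort : sorts of the theory, ⟦_⟧ : interpretation (domain of each sort)
--  * Pred : predicate symbols (including `false`, of arity []),
--    ar p : the (sorted) arity of p.
--  * A constraint over the variables Γ of a clause is given semantically, as
--    the set of valuations of Γ satisfying it.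
--  * Variables of a clause are typed positions in its context ctx; an atom
--    q(x̄) is q together with a tuple of variables of ctx of the sorts ar q.

module CHC {Sort : Set} (⟦_⟧ : Sort → Set) {Pred : Set} (ar : Pred → List Sort) where

  Tuple : List Sort → Set
  Tuple = All ⟦_⟧

  Args : List Sort → List Sort → Set
  Args Γ ss = All (_∈ Γ) ss

  Atom : List Sort → Set
  Atom Γ = Σ Pred (λ q → Args Γ (ar q))

  record Clause : Set₁ where
    field
      ctx        : List Sort
      head       : Pred
      hargs      : Args ctx (ar head)
      constraint : Tuple ctx → Set
      body       : List (Atom ctx)

  record Program : Set₁ where
    field
      size   : ℕ
      clause : Fin size → Clause

  eval : ∀ {Γ ss} → Tuple Γ → Args Γ ss → Tuple ss
  eval v = All.map (lookup v)

  evalBody : ∀ {Γ} → Tuple Γ → (bs : List (Atom Γ)) →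
             All (λ q → Tuple (ar q)) (map proj₁ bs)
  evalBody v []             = []
  evalBody v ((q , xs) ∷ bs) = eval v xs ∷ evalBody v bs

  module _ (P : Program) where
    open Program P
    open Clause

    data Tree : Pred → Set
    data Forest : List Pred → Set

    data Tree where
      node : (i : Fin size) → Forest (map proj₁ (body (clause i))) →
             Tree (head (clause i))

    data Forest where
      []  : Forest []
      _∷_ : ∀ {q qs} → Tree q → Forest qs → Forest (q ∷ qs)

    -- Variables of a tree: the disjoint union of (renamed-apart) copies of
    -- the variables of the clause at each node; an assignment to them is
    -- thus one valuation per node.
    Asg  : ∀ {p} → Tree p → Set
    AsgF : ∀ {qs} → Forest qs → Set
    Asg (node i ts) = Tuple (ctx (clause i)) × AsgF ts
    AsgF []       = ⊤
    AsgF (t ∷ ts) = Asg t × AsgF ts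

    rootLabel : ∀ {p} (t : Tree p) → Asg t → Tuple (ar p)
    rootLabel (node i ts) (v , _) = eval v (hargs (clause i))

    -- constr(t): the constraints at every node, together with the
    -- identification of each child's head with the corresponding body
    -- atom of its parent (the child is labelled by that atom).
    constr  : ∀ {p} (t : Tree p) → Asg t → Set
    constrF : ∀ {qs} (ts : Forest qs) → AsgF ts → All (λ q → Tuple (ar q)) qs → Set
    constr (node i ts) (v , as) =
      constraint (clause i) v × constrF ts as (evalBody v (body (clause i)))
    constrF []       _        _        = ⊤
    constrF (t ∷ ts) (a , as) (u ∷ us) = (rootLabel t a ≡ u) × constr t a × constrF ts as us

    Feasible : ∀ {p} → Tree p → Set
    Feasible t = Σ (Asg t) (constr t)

    IsDerivationOf : ∀ {p} → Tree p → Tuple (ar p) → Set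
    IsDerivationOf t u = Σ (Asg t) (λ a → constr t a × rootLabel t a ≡ u)

    Derivable : (p : Pred) → Tuple (ar p) → Set
    Derivable p u = Σ (Tree p) (λ t → IsDerivationOf t u)

    dim  : ∀ {p} → Tree p → ℕ
    dims : ∀ {qs} → Forest qs → List ℕ
    dim (node i ts) = dimOf (dims ts)
    dims []       = []
    dims (t ∷ ts) = dim t ∷ dims ts

module DimInstr {Sort : Set} (⟦_⟧ : Sort → Set) {Pred : Set} (ar : Pred → List Sort) where

  Sort' : Set
  Sort' = Sort ⊎ ⊤

  ⟦_⟧' : Sort' → Set
  ⟦ inj₁ s ⟧' = ⟦ s ⟧
  ⟦ inj₂ _ ⟧' = ℕ

  κ : Sort'
  κ = inj₂ tt

  ar' : Pred → List Sort'
  ar' p = map inj₁ (ar p) ++ (κ ∷ [])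

  module S = CHC ⟦_⟧ ar
  module D = CHC ⟦_⟧' ar'

  liftTuple : ∀ {ss} → S.Tuple ss → D.Tuple (map inj₁ ss)
  liftTuple []       = []
  liftTuple (x ∷ xs) = x ∷ liftTuple xs

  extend : ∀ {p} → S.Tuple (ar p) → ℕ → D.Tuple (ar' p)
  extend t k = ++⁺ (liftTuple t) (k ∷ [])

  restrict : ∀ Γ {E} → D.Tuple (map inj₁ Γ ++ E) → S.Tuple Γ
  restrict []      _        = []
  restrict (s ∷ Γ) (x ∷ xs) = x ∷ restrict Γ xs

  liftArgs : ∀ {Γ Γ' ss} → (∀ {s} → s ∈ map inj₁ Γ → s ∈ Γ') →
             S.Args Γ ss → D.Args Γ' (map inj₁ ss)
  liftArgs lift []       = []
  liftArgs lift (m ∷ ms) = lift (∈-map⁺ inj₁ m) ∷ liftArgs lift ms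

  -- body atoms pᵢ'(x̄ᵢ, kᵢ), with kᵢ the i-th fresh variable
  mkBody : ∀ {Γ Γ'} (bs : List (S.Atom Γ)) →
           (κ ∈ replicate (length bs) κ → κ ∈ Γ') →
           (∀ {s} → s ∈ map inj₁ Γ → s ∈ Γ') →
           List (D.Atom Γ')
  mkBody []             emb lift = []
  mkBody ((q , xs) ∷ bs) emb lift =
    (q , ++⁺ (liftArgs lift xs) (emb (here refl) ∷ []))
    ∷ mkBody bs (λ m → emb (there m)) lift

  kvals : ∀ {Γ'} (n : ℕ) → (κ ∈ replicate n κ → κ ∈ Γ') → D.Tuple Γ' → List ℕ
  kvals zero    emb v = []
  kvals (suc n) emb v = lookup v (emb (here refl)) ∷ kvals n (λ m → emb (there m)) v

  transform : S.Clause → D.Clause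
  transform c = record
    { ctx        = Γ'
    ; head       = head
    ; hargs      = ++⁺ (liftArgs ∈-++⁺ˡ hargs) (kHere ∷ [])
    ; constraint = λ v' → constraint (restrict ctx v')
                          × (lookup v' kHere ≡ dimOf (kvals n emb v'))
    ; body       = mkBody body emb (λ m → ∈-++⁺ˡ m)
    }
    where
      open S.Clause c
      n  = length body
      E  = κ ∷ replicate n κ
      Γ' = map inj₁ ctx ++ E
      kHere : κ ∈ Γ'
      kHere = ∈-++⁺ʳ (map inj₁ ctx) (here refl)
      emb : κ ∈ replicate n κ → κ ∈ Γ'
      emb m = ∈-++⁺ʳ (map inj₁ ctx) (there m)

  dimProgram : S.Program → D.Program
  dimProgram P = record { size = S.Program.size P
                        ; clause = λ i → transform (S.Program.clause P i) }

module Submission where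

-- Clause i of P_dim is clause i of P whose variable context is
-- extended by a head variable k and one fresh variable kⱼ per body atom,
-- with the extra constraint k = dimOf [k₁,…,kₙ].  Hence AND-trees of P and
-- of P_dim have the same shape (same clause at every node), and we
-- translate feasible trees in both directions by structural recursion:
--   * P → P_dim: extend the valuation at every node by k := dim of the
--     node's subtree and kⱼ := dim of the j-th child subtree; the new
--     constraint then holds by the definition of dim;
--   * P_dim → P: restrict every valuation to the original variables; the
--     constraint k = dimOf [k₁,…,kₙ] forces the value of k to be the dim
--     of the translated subtree.
-- In both cases the root label of the P_dim tree is the root label of the
-- P tree extended by its dimension.

open import Defs
open import Data.Nat using (ℕ)
open import Data.List using (List; []; _∷_; map; _++_; length; replicate)
open import Data.List.Relation.Unary.All using (All; []; _∷_; lookup; head; tail)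
open import Data.List.Relation.Unary.All.Properties using (++⁺)
open import Data.List.Relation.Unary.Any using (here; there)
open import Data.List.Membership.Propositional using (_∈_)
open import Data.List.Membership.Propositional.Properties using (∈-map⁺; ∈-++⁺ˡ; ∈-++⁺ʳ)
open import Data.List.Properties using (∷-injectiveˡ; ∷-injectiveʳ)
open import Data.Product using (Σ; _×_; _,_; proj₁)
open import Data.Sum using (inj₁)
open import Data.Unit using (tt)
open import Function.Bundles using (_⇔_; mk⇔)
open import Relation.Binary.PropositionalEquality using (_≡_; refl; sym; trans; cong; cong₂; subst; module ≡-Reasoning)

module Instrumentation {Sort : Set} (⟦_⟧ : Sort → Set) {Pred : Set} (ar : Pred → List Sort) where
  open DimInstr ⟦_⟧ ar

  -- The tuple (t̄ , k) for a tuple t̄ of any sorts (`extend` is its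
  -- instance at the arity of a predicate).
  extendTuple : ∀ {ss} → S.Tuple ss → ℕ → D.Tuple (map inj₁ ss ++ κ ∷ [])
  extendTuple t k = ++⁺ (liftTuple t) (k ∷ [])

  extendTuple-injective : ∀ ss {t t' : S.Tuple ss} {k k' : ℕ} →
    extendTuple t k ≡ extendTuple t' k' → t ≡ t' × k ≡ k'
  extendTuple-injective []       {[]}    {[]}     refl = refl , refl
  extendTuple-injective (_ ∷ ss) {_ ∷ _} {_ ∷ _} eq
    with extendTuple-injective ss (cong tail eq)
  ... | t≡t' , k≡k' = cong₂ _∷_ (cong head eq) t≡t' , k≡k'

  lookup-restrict : ∀ Γ {E} (v' : D.Tuple (map inj₁ Γ ++ E)) {s} (x : s ∈ Γ) →
    lookup v' (∈-++⁺ˡ (∈-map⁺ inj₁ x)) ≡ lookup (restrict Γ v') x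
  lookup-restrict (_ ∷ Γ) (_ ∷ v') (here refl) = refl
  lookup-restrict (_ ∷ Γ) (_ ∷ v') (there x)   = lookup-restrict Γ v' x

  lookup-fresh : ∀ Γ {E} (v : S.Tuple Γ) (e : D.Tuple E) {s} (x : s ∈ E) →
    lookup (++⁺ (liftTuple v) e) (∈-++⁺ʳ (map inj₁ Γ) x) ≡ lookup e x
  lookup-fresh []      []      e x = refl
  lookup-fresh (_ ∷ Γ) (_ ∷ v) e x = lookup-fresh Γ v e x

  restrict-lift : ∀ Γ {E} (v : S.Tuple Γ) (e : D.Tuple E) →
    restrict Γ (++⁺ (liftTuple v) e) ≡ v
  restrict-lift []      []      e = refl
  restrict-lift (_ ∷ Γ) (x ∷ v) e = cong (x ∷_) (restrict-lift Γ v e)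

  eval-liftArgs : ∀ Γ {E ss} (v' : D.Tuple (map inj₁ Γ ++ E)) (xs : S.Args Γ ss) →
    D.eval v' (liftArgs (λ x → ∈-++⁺ˡ x) xs) ≡ liftTuple (S.eval (restrict Γ v') xs)
  eval-liftArgs Γ v' []       = refl
  eval-liftArgs Γ v' (x ∷ xs) = cong₂ _∷_ (lookup-restrict Γ v' x) (eval-liftArgs Γ v' xs)

  eval-++⁺ : ∀ {Γ as bs} (v : D.Tuple Γ) (xs : D.Args Γ as) (ys : D.Args Γ bs) →
    D.eval v (++⁺ xs ys) ≡ ++⁺ (D.eval v xs) (D.eval v ys)
  eval-++⁺ v []       ys = refl
  eval-++⁺ v (x ∷ xs) ys = cong (_ ∷_) (eval-++⁺ v xs ys)

  -- An instrumented atom q'(x̄, k) evaluates to (value of q(x̄) on the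
  -- restricted valuation , value of k): both head and body atoms of
  -- transformed clauses have this shape.
  eval-instrumented : ∀ Γ {E ss} (v' : D.Tuple (map inj₁ Γ ++ E))
    (xs : S.Args Γ ss) (k : κ ∈ map inj₁ Γ ++ E) →
    D.eval v' (++⁺ (liftArgs (λ x → ∈-++⁺ˡ x) xs) (k ∷ []))
      ≡ extendTuple (S.eval (restrict Γ v') xs) (lookup v' k)
  eval-instrumented Γ v' xs k =
    trans (eval-++⁺ v' (liftArgs (λ x → ∈-++⁺ˡ x) xs) (k ∷ []))
          (cong (λ u → ++⁺ u (lookup v' k ∷ [])) (eval-liftArgs Γ v' xs))

  module Translation (P : S.Program) where
    open S.Program P
    open S.Clause
    open S using (node; []; _∷_)
    open D using () renaming (node to node′; [] to []′; _∷_ to _∷′_)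

    P' : D.Program
    P' = dimProgram P

    body' : ∀ {Γ E} (bs : List (S.Atom Γ)) →
      (κ ∈ replicate (length bs) κ → κ ∈ map inj₁ Γ ++ E) → List (D.Atom (map inj₁ Γ ++ E))
    body' bs fresh = mkBody bs fresh (λ x → ∈-++⁺ˡ x)

    childDims : ∀ {Γ} (bs : List (S.Atom Γ)) → S.Forest P (map proj₁ bs) →
      D.Tuple (replicate (length bs) κ)
    childDims []       []       = []
    childDims (_ ∷ bs) (t ∷ ts) = S.dim P t ∷ childDims bs ts

    kvals-childDims : ∀ {Γ Γ'} (bs : List (S.Atom Γ)) (ts : S.Forest P (map proj₁ bs))
      (fresh : κ ∈ replicate (length bs) κ → κ ∈ Γ') (v' : D.Tuple Γ') →
      (∀ x → lookup v' (fresh x) ≡ lookup (childDims bs ts) x) →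
      kvals (length bs) fresh v' ≡ S.dims P ts
    kvals-childDims []       []       fresh v' hyp = refl
    kvals-childDims (_ ∷ bs) (_ ∷ ts) fresh v' hyp =
      cong₂ _∷_ (hyp (here refl))
                (kvals-childDims bs ts (λ x → fresh (there x)) v' (λ x → hyp (there x)))

    instrument : ∀ {p} (d : S.Tree P p) (a : S.Asg P d) → S.constr P d a →
      D.Derivable P' p (extendTuple (S.rootLabel P d a) (S.dim P d))
    instrumentForest : ∀ {Γ E} (bs : List (S.Atom Γ)) (ts : S.Forest P (map proj₁ bs))
      (as : S.AsgF P ts) (v' : D.Tuple (map inj₁ Γ ++ E)) →
      S.constrF P ts as (S.evalBody (restrict Γ v') bs) →
      (fresh : κ ∈ replicate (length bs) κ → κ ∈ map inj₁ Γ ++ E) →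
      kvals (length bs) fresh v' ≡ S.dims P ts →
      Σ (D.Forest P' (map proj₁ (body' bs fresh))) λ ts' →
        Σ (D.AsgF P' ts') λ as' → D.constrF P' ts' as' (D.evalBody v' (body' bs fresh))

    instrument (node i ts) (v , as) (φ , cs) =
      let (ts' , as' , cs') = instrumentForest bs ts as v' csRestricted fresh kvals-v'
      in node′ i ts' , (v' , as') , ((φRestricted , dimConstraint) , cs') , rootLabel'
      where
        Γ  = ctx (clause i)
        bs = body (clause i)
        kv = S.dim P (node i ts) ∷ childDims bs ts
        v' = ++⁺ (liftTuple v) kv
        restrict-v' : restrict Γ v' ≡ v
        restrict-v' = restrict-lift Γ v kv
        φRestricted = subst (constraint (clause i)) (sym restrict-v') φ
        csRestricted = subst (λ u → S.constrF P ts as (S.evalBody u bs)) (sym restrict-v') cs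
        kHead = ∈-++⁺ʳ (map inj₁ Γ) (here refl)
        fresh : κ ∈ replicate (length bs) κ → κ ∈ map inj₁ Γ ++ κ ∷ replicate (length bs) κ
        fresh x = ∈-++⁺ʳ (map inj₁ Γ) (there x)
        kvals-v' : kvals (length bs) fresh v' ≡ S.dims P ts
        kvals-v' = kvals-childDims bs ts fresh v' (λ x → lookup-fresh Γ v kv (there x))
        dimConstraint : lookup v' kHead ≡ dimOf (kvals (length bs) fresh v')
        dimConstraint = trans (lookup-fresh Γ v kv (here refl)) (cong dimOf (sym kvals-v'))
        rootLabel' : D.eval v' (++⁺ (liftArgs (λ x → ∈-++⁺ˡ x) (hargs (clause i))) (kHead ∷ []))
                     ≡ extendTuple (S.eval v (hargs (clause i))) (S.dim P (node i ts))
        rootLabel' = trans (eval-instrumented Γ v' (hargs (clause i)) kHead)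
          (cong₂ extendTuple (cong (λ u → S.eval u (hargs (clause i))) restrict-v')
                             (lookup-fresh Γ v kv (here refl)))

    instrumentForest [] [] _ _ _ _ _ = []′ , tt , tt
    instrumentForest {Γ} ((_ , xs) ∷ bs) (t ∷ ts) (a , as) v' (root , c , cs) fresh kvals≡
      with instrument t a c
         | instrumentForest bs ts as v' cs (λ x → fresh (there x)) (∷-injectiveʳ kvals≡)
    ... | t' , a' , c' , root' | ts' , as' , cs' =
      (t' ∷′ ts') , (a' , as') , (rootMatches , c' , cs')
      where
        open ≡-Reasoning
        k₁ = fresh (here refl)
        rootMatches = begin
          D.rootLabel P' t' a'                                   ≡⟨ root' ⟩
          extendTuple (S.rootLabel P t a) (S.dim P t)            ≡⟨ cong₂ extendTuple root (sym (∷-injectiveˡ kvals≡)) ⟩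
          extendTuple (S.eval (restrict Γ v') xs) (lookup v' k₁) ≡⟨ sym (eval-instrumented Γ v' xs k₁) ⟩
          D.eval v' (++⁺ (liftArgs (λ x → ∈-++⁺ˡ x) xs) (k₁ ∷ [])) ∎

    forget : ∀ {p} (d' : D.Tree P' p) (a' : D.Asg P' d') → D.constr P' d' a' →
      Σ (S.Tree P p) λ d → Σ (S.Asg P d) λ a →
        S.constr P d a × extendTuple (S.rootLabel P d a) (S.dim P d) ≡ D.rootLabel P' d' a'
    forgetForest : ∀ {Γ E} (bs : List (S.Atom Γ))
      (fresh : κ ∈ replicate (length bs) κ → κ ∈ map inj₁ Γ ++ E)
      (ts' : D.Forest P' (map proj₁ (body' bs fresh))) (as' : D.AsgF P' ts')
      (v' : D.Tuple (map inj₁ Γ ++ E)) →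
      D.constrF P' ts' as' (D.evalBody v' (body' bs fresh)) →
      Σ (S.Forest P (map proj₁ bs)) λ ts → Σ (S.AsgF P ts) λ as →
        S.constrF P ts as (S.evalBody (restrict Γ v') bs) × S.dims P ts ≡ kvals (length bs) fresh v'

    forget (node′ i ts') (v' , as') ((φ , dimConstraint) , cs')
      with forgetForest (body (clause i)) (λ x → ∈-++⁺ʳ (map inj₁ (ctx (clause i))) (there x)) ts' as' v' cs'
    ... | ts , as , cs , dims≡ =
      node i ts , (restrict Γ v' , as) , (φ , cs) , rootLabel
      where
        open ≡-Reasoning
        Γ = ctx (clause i)
        kHead = ∈-++⁺ʳ (map inj₁ Γ) (here refl)
        rootLabel = begin
          extendTuple (S.eval (restrict Γ v') (hargs (clause i))) (dimOf (S.dims P ts))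
            ≡⟨ cong (extendTuple _) (trans (cong dimOf dims≡) (sym dimConstraint)) ⟩
          extendTuple (S.eval (restrict Γ v') (hargs (clause i))) (lookup v' kHead)
            ≡⟨ sym (eval-instrumented Γ v' (hargs (clause i)) kHead) ⟩
          D.eval v' (++⁺ (liftArgs (λ x → ∈-++⁺ˡ x) (hargs (clause i))) (kHead ∷ [])) ∎

    forgetForest [] _ []′ _ _ _ = [] , tt , tt , refl
    forgetForest {Γ} ((q , xs) ∷ bs) fresh (t' ∷′ ts') (a' , as') v' (root' , c' , cs')
      with forget t' a' c' | forgetForest bs (λ x → fresh (there x)) ts' as' v' cs'
    ... | t , a , c , root | ts , as , cs , dims≡
      with extendTuple-injective (ar q)
             (trans root (trans root' (eval-instrumented Γ v' xs (fresh (here refl)))))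
    ... | rootMatches , dimMatches = (t ∷ ts) , (a , as) , (rootMatches , c , cs) , cong₂ _∷_ dimMatches dims≡

proposition1 : {Sort : Set} (⟦_⟧ : Sort → Set) {Pred : Set} (ar : Pred → List Sort)
    (P : CHC.Program ⟦_⟧ ar) (p : Pred) (t : CHC.Tuple ⟦_⟧ ar (ar p)) (k : ℕ) →
    CHC.Derivable (DimInstr.⟦_⟧' ⟦_⟧ ar) (DimInstr.ar' ⟦_⟧ ar)
    (DimInstr.dimProgram ⟦_⟧ ar P) p (DimInstr.extend ⟦_⟧ ar {p} t k)
    ⇔ Σ (CHC.Tree ⟦_⟧ ar P p)
    (λ d → CHC.IsDerivationOf ⟦_⟧ ar P d t × CHC.dim ⟦_⟧ ar P d ≡ k)
proposition1 ⟦_⟧ ar P p t k = mk⇔ fromInstrumented toInstrumented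
  where
    open Instrumentation ⟦_⟧ ar
    open Translation P
    open DimInstr ⟦_⟧ ar using (module S; module D)

    fromInstrumented : D.Derivable P' p (extendTuple t k) →
      Σ (S.Tree P p) (λ d → S.IsDerivationOf P d t × S.dim P d ≡ k)
    fromInstrumented (d' , a' , c' , root') with forget d' a' c'
    ... | d , a , c , root with extendTuple-injective (ar p) (trans root root')
    ...   | rootIsT , dimIsK = d , (a , c , rootIsT) , dimIsK

    toInstrumented : Σ (S.Tree P p) (λ d → S.IsDerivationOf P d t × S.dim P d ≡ k) →
      D.Derivable P' p (extendTuple t k)
    toInstrumented (d , (a , c , rootIsT) , dimIsK) =
      subst (D.Derivable P' p) (cong₂ extendTuple rootIsT dimIsK) (instrument d a c)
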